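{- Let $s_0,s_1,\dots,s_k$ with $s_i=(\vec q_i,P_i,\Phi_i)$ be a spurious counterexample, where for each $i\in[1,k]$, $\theta_i(\vec x_{\mathcal A},\vec x_{\mathcal A}')$ is the formula of the rule $(\vec q_{i-1},P_{i-1})\xrightarrow{\sigma_i,\theta_i}(\vec q_i,P_i)$ of $\mathcal{A}^e\times\overline B$, let $j\geq 0$ be its pivot, and let $\Pi$ be a predicate map compatible with it. Then there is no sequence of product states $(\vec q_j,P_j,\Psi_0),(\vec q_{j+1},P_{j+1},\Psi_1),\dots,(\vec q_k,P_k,\Psi_{k-j})$ such that (1) $\Psi_0\rightarrow\Phi_j$ is valid and (2) $(\vec q_{i+1},P_{i+1},\Psi_{i-j+1})\in\mathit{Post}_\Pi((\vec q_i,P_i,\Psi_{i-j}))$ for all $i\in[j,k-1]$.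
   Context: Data automata (DA): $\mathcal{D}$ is a data domain with first-order theory $\mathrm{Th}(\mathcal D)$ closed under conjunction and negation; a DA $\langle\mathcal D,\Sigma,\vec x,Q,\iota,F,\Delta\rangle$ has finite alphabet $\Sigma$, finite variables $\vec x$, finite states $Q$, initial $\iota$, final $F\subseteq Q$, and rules $q\xrightarrow{\sigma,\phi(\vec x,\vec x')}q'$ with $\phi\in\mathrm{Th}(\mathcal D)$; configuration $(q',\nu')$ is a successor of $(q,\nu)$ if some rule $q\xrightarrow{\sigma,\phi}q'$ has $(\nu,\nu')\models\phi$. Network: $\mathcal A=\langle A_1,\dots,A_N\rangle$, $A_i=\langle\mathcal D,\Sigma_i,\vec x_i,Q_i,\iota_i,F_i,\Delta_i\rangle$ with pairwise disjoint state sets; its expansion $\mathcal A^e$ has alphabet $\bigcup\Sigma_i$, variables $\vec x_{\mathcal A}=\bigcup\vec x_i$, states $Q_1\times\dots\times Q_N$, initial $\langle\iota_1,\dots,\iota_N\rangle$, final $F_1\times\dots\times F_N$, and rules $\langle q_1,\dots,q_N\rangle\xrightarrow{\sigma,\varphi}\langle q_1',\dots,q_N'\rangle$ where, with $I$ the set of indices $i$ having a rule $q_i\xrightarrow{\sigma,\varphi_i}q_i'\in\Delta_i$, one has $q_j=q_j'$ for $j\notin I$ and $\varphi\equiv\bigwedge_{i\in I}\varphi_i\wedge\bigwedge_{j\notin I}\bigwedge_{x\in\vec x_j\setminus\bigcup_{i\in I}\vec x_i}x'=x$. Observer: DA $B=\langle\mathcal D,\Sigma,\vec x_B,Q_B,\iota_B,F_B,\Delta_B\rangle$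 with $\vec x_B\subseteq\vec x_{\mathcal A}$. Its complement $\overline B$ has states $2^{Q_B}$, initial $\{\iota_B\}$, and rules $P\xrightarrow{\sigma,\theta}P'$ whenever every $p'\in P'$ has a $\sigma$-rule from some $p\in P$, with $\theta\equiv\bigwedge_{p'\in P'}\bigvee_{p\in P,\,p\xrightarrow{\sigma,\psi}p'\in\Delta_B}\psi\wedge\bigwedge_{p'\notin P'}\bigwedge_{p\in P,\,p\xrightarrow{\sigma,\varphi}p'\in\Delta_B}\neg\varphi$. The product $\mathcal A^e\times\overline B$ has variables $\vec x_{\mathcal A}$, states $(\vec q,P)$, rules $(\vec q,P)\xrightarrow{\sigma,\varphi\wedge\theta}(\vec q',P')$ for a rule $\vec q\xrightarrow{\sigma,\varphi}\vec q'$ of $\mathcal A^e$ and $P\xrightarrow{\sigma,\theta}P'$ of $\overline B$; $(\vec q,P)$ is accepting iff $\vec q\in F_1\times\dots\times F_N$ and $P\cap F_B=\emptyset$. A product state is $s=(\vec q,P,\Phi)$ with $\Phi(\vec x_{\mathcal A})\in\mathrm{Th}(\mathcal D)$; it is accepting if $(\vec q,P)$ is. $\mathit{Post}(s)$ is the set of $(\vec r,S,\Psi)$ such that there is a product rule $(\vec q,P)\xrightarrow{\sigma,\theta}(\vec r,S)$ and $\Psi(\vec x_{\mathcal A})\equiv\exists\vec x'_{\mathcal A}.\,\Phi(\vec x'_{\mathcal A})\wedge\theta(\vec x'_{\mathcal A},\vec x_{\mathcal A})$ is satisfiable. A substate of $(\langle q_1,\dots,q_N\rangle,P)$ is a pair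 $(\langle q_{i_1},\dots,q_{i_m}\rangle,S)$ where $i_1<\dots<i_m$ and $S\subseteq Q_B$ with $S\neq\emptyset$ only if $S\cap P\neq\emptyset$; write $r\vartriangleleft(\vec q,P)$. A predicate map $\Pi$ assigns to each substate $(\langle q_{i_1},\dots,q_{i_m}\rangle,S)$ a set of formulae over $\vec x_{i_1}\cup\dots\cup\vec x_{i_m}$ (together with $\vec x_B$ if $S\neq\emptyset$). $\mathit{Post}_\Pi(s)$ is the set of $(\vec r,S,\Psi^\sharp)$ such that $(\vec r,S,\Psi)\in\mathit{Post}(s)$ and $\Psi^\sharp\equiv\bigwedge_{r\vartriangleleft(\vec r,S)}\bigwedge\{\pi\in\Pi(r)\mid\Psi\rightarrow\pi\text{ valid}\}$. A counterexample is a sequence $s_0,\dots,s_k$ of product states with $s_0=(\langle\iota_1,\dots,\iota_N\rangle,\{\iota_B\},\top)$, $s_i\in\mathit{Post}_{\Pi_i}(s_{i-1})$ for some predicate map $\Pi_i$ ($i\in[1,k]$), and $s_k$ accepting. For $j\in[0,k]$ let $\Theta^j\equiv\Phi_j(\vec x^0)\wedge\bigwedge_{i=j+1}^{k}\theta_i(\vec x^{i-j-1},\vec x^{i-j})$ using fresh indexed copies $\vec x^m$ of $\vec x_{\mathcal A}$. The pivot is the maximal $j\in[0,k]$ with $\Theta^j$ unsatisfiable, and $-1$ if none exists; the counterexample is spurious if the pivot is $\geq0$. An interpolant for $\Phi_j$ and $\langle\theta_{j+1},\dots,\theta_k\rangle$ is a sequence $\langle I_0,\dots,I_{k-j}\rangle$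 of formulae over $\vec x_{\mathcal A}$ with $\Phi_j\rightarrow I_0$, $I_{k-j}\rightarrow\bot$, and $I_{i-1}(\vec x)\wedge\theta_{j+i}(\vec x,\vec x')\rightarrow I_i(\vec x')$ for $i\in[1,k-j]$ (all valid). $\Pi$ is compatible with the spurious counterexample with pivot $j$ if there is such an interpolant such that for each $i\in[0,k-j]$ and each clause $C$ of some conjunctive normal form of $I_i$, $C\in\Pi(r)$ for some substate $r\vartriangleleft(\vec q_{i+j},P_{i+j})$. -}

module Defs where

open import Data.Nat using (ℕ; zero; suc; _+_; _∸_; _≤_; _<_)
open import Data.Fin using (Fin; zero; suc; splitAt)
open import Data.Fin.Subset using (Subset; _∈_; _∉_; _∩_; Nonempty; ⁅_⁆)
open import Data.List using (List; []; _∷_)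
open import Data.List.Relation.Unary.All using (All)
open import Data.List.Membership.Propositional using () renaming (_∈_ to _∈L_)
open import Data.Maybe using (Maybe; just; nothing)
open import Data.Product using (Σ; Σ-syntax; ∃; _×_; _,_)
open import Data.Sum using (_⊎_; [_,_])
open import Data.Unit using (⊤)
open import Data.Empty using (⊥)
open import Relation.Nullary using (¬_)
open import Relation.Binary.PropositionalEquality using (_≡_)
open import Function.Bundles using (_⇔_)

-- Atomic relations are
-- abstract, with a Tarskian interpretation in D; equality is built in.

record Theory : Set₁ where
  field
    D        : Set
    d₀       : D                                   -- a structure is nonempty
    Atom     : ℕ → Set
    ⟦_⟧ₐ     : ∀ {m} → Atom m → (Fin m → D) → Set
    atomVars : ∀ {m} → Atom m → List (Fin m)

module FO (T : Theory) where
  open Theory T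

  Val : ℕ → Set
  Val m = Fin m → D

  data Atomic (m : ℕ) : Set where
    rel  : Atom m → Atomic m
    _≐_  : Fin m → Fin m → Atomic m

  -- first-order formulas; ∃f binds variable zero (de Bruijn style)
  data Formula : ℕ → Set where
    at   : ∀ {m} → Atomic m → Formula m
    ⊤f   : ∀ {m} → Formula m
    ⊥f   : ∀ {m} → Formula m
    ¬f   : ∀ {m} → Formula m → Formula m
    _∧f_ : ∀ {m} → Formula m → Formula m → Formula m
    _∨f_ : ∀ {m} → Formula m → Formula m → Formula m
    ∃f   : ∀ {m} → Formula (suc m) → Formula m

  ext : ∀ {m} → D → Val m → Val (suc m)
  ext d ν zero    = d
  ext d ν (suc v) = ν v

  ⟦_⟧at : ∀ {m} → Atomic m → Val m → Set
  ⟦ rel a ⟧at ν = ⟦ a ⟧ₐ ν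
  ⟦ x ≐ y ⟧at ν = ν x ≡ ν y

  ⟦_⟧ : ∀ {m} → Formula m → Val m → Set
  ⟦ at a ⟧ ν    = ⟦ a ⟧at ν
  ⟦ ⊤f ⟧ ν      = ⊤
  ⟦ ⊥f ⟧ ν      = ⊥
  ⟦ ¬f φ ⟧ ν    = ¬ ⟦ φ ⟧ ν
  ⟦ φ ∧f ψ ⟧ ν  = ⟦ φ ⟧ ν × ⟦ ψ ⟧ ν
  ⟦ φ ∨f ψ ⟧ ν  = ⟦ φ ⟧ ν ⊎ ⟦ ψ ⟧ ν
  ⟦ ∃f φ ⟧ ν    = Σ D λ d → ⟦ φ ⟧ (ext d ν)

  _⇒_ : ∀ {m} → Formula m → Formula m → Set
  φ ⇒ ψ = ∀ ν → ⟦ φ ⟧ ν → ⟦ ψ ⟧ ν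

  Sat : ∀ {m} → Formula m → Set
  Sat φ = Σ (Val _) λ ν → ⟦ φ ⟧ ν

  liftU : ∀ {m} → (Fin m → Set) → Fin (suc m) → Set
  liftU U zero    = ⊤
  liftU U (suc v) = U v

  FreeInAt : ∀ {m} → (Fin m → Set) → Atomic m → Set
  FreeInAt U (rel a) = All U (atomVars a)
  FreeInAt U (x ≐ y) = U x × U y

  FreeIn : ∀ {m} → (Fin m → Set) → Formula m → Set
  FreeIn U (at a)    = FreeInAt U a
  FreeIn U ⊤f        = ⊤
  FreeIn U ⊥f        = ⊤
  FreeIn U (¬f φ)    = FreeIn U φ
  FreeIn U (φ ∧f ψ)  = FreeIn U φ × FreeIn U ψ
  FreeIn U (φ ∨f ψ)  = FreeIn U φ × FreeIn U ψ
  FreeIn U (∃f φ)    = FreeIn (liftU U) φ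

  -- Two-vocabulary formulas φ(x, x') over n variables live in scope n + n:
  -- the first block is x (unprimed), the second block is x' (primed).
  pairV : ∀ {n} → Val n → Val n → Val (n + n)
  pairV {n} ν ν' v = [ ν , ν' ] (splitAt n v)

  pairU : ∀ {n} → (Fin n → Set) → Fin (n + n) → Set
  pairU {n} U v = [ U , U ] (splitAt n v)

  data Literal (m : ℕ) : Set where
    pos neg : Atomic m → Literal m

  litF : ∀ {m} → Literal m → Formula m
  litF (pos a) = at a
  litF (neg a) = ¬f (at a)

  Clause CNF : ℕ → Set
  Clause m = List (Literal m)
  CNF m    = List (Clause m)

  clauseF : ∀ {m} → Clause m → Formula m
  clauseF []           = ⊥f
  clauseF (l ∷ [])     = litF l
  clauseF (l ∷ l' ∷ ls) = litF l ∨f clauseF (l' ∷ ls)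

  cnfF : ∀ {m} → CNF m → Formula m
  cnfF []            = ⊤f
  cnfF (c ∷ [])      = clauseF c
  cnfF (c ∷ c' ∷ cs) = clauseF c ∧f cnfF (c' ∷ cs)

  IsCNFOf : ∀ {m} → CNF m → Formula m → Set
  IsCNFOf cs φ = ∀ ν → ⟦ φ ⟧ ν ⇔ ⟦ cnfF cs ⟧ ν

record Rule (T : Theory) (L n nQ : ℕ) : Set where
  constructor rule
  field
    src : Fin nQ
    lab : Fin L
    fml : FO.Formula T (n + n)
    tgt : Fin nQ

record DA (T : Theory) (L n : ℕ) : Set where
  field
    alph  : Subset L
    vars  : Subset n
    nQ    : ℕ
    ι     : Fin nQ
    F     : Subset nQ
    Δ     : List (Rule T L n nQ)
    Δ-alph : All (λ r → Rule.lab r ∈ alph) Δ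
    Δ-vars : All (λ r → FO.FreeIn T (FO.pairU T (_∈ vars)) (Rule.fml r)) Δ

-- A network ⟨A₁,…,A_N⟩; the variable universe Fin n is x⃗_𝒜 = ⋃ x⃗ᵢ and
-- the letters Fin L are ⋃ Σᵢ.  State sets are disjoint by construction.
record Network (T : Theory) (L n : ℕ) : Set where
  field
    N          : ℕ
    A          : Fin N → DA T L n
    vars-cover : ∀ x → ∃ λ i → x ∈ DA.vars (A i)
    alph-cover : ∀ σ → ∃ λ i → σ ∈ DA.alph (A i)

-- An observer: a DA over the whole alphabet, with x⃗_B ⊆ x⃗_𝒜 = Fin n.
record Observer (T : Theory) (L n : ℕ) : Set where
  field
    B        : DA T L n
    alph-all : ∀ σ → σ ∈ DA.alph B

module Net (T : Theory) {L n : ℕ} (𝒜 : Network T L n) (Ob : Observer T L n) where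
  open FO T
  open Network 𝒜
  open Observer Ob using (B)
  open DA

  GState : Set
  GState = (i : Fin N) → Fin (nQ (A i))

  nB : ℕ
  nB = nQ B

  Fml : ℕ → Set
  Fml = Formula

  -- rules q⃗ --σ,φ--> q⃗' of the expansion 𝒜ᵉ (φ up to logical equivalence)
  ExpRule : GState → Fin L → Fml (n + n) → GState → Set
  ExpRule q σ φ q' =
    Σ[ ρ ∈ ((i : Fin N) → σ ∈ alph (A i) → Rule T L n (nQ (A i))) ]
      ( (∀ i h → (ρ i h ∈L Δ (A i)) × (Rule.src (ρ i h) ≡ q i)
                  × (Rule.lab (ρ i h) ≡ σ) × (Rule.tgt (ρ i h) ≡ q' i))
      × (∀ j → σ ∉ alph (A j) → q j ≡ q' j)
      × (∀ ν ν' → ⟦ φ ⟧ (pairV {n} ν ν') ⇔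
           ( (∀ i (h : σ ∈ alph (A i)) → ⟦ Rule.fml (ρ i h) ⟧ (pairV {n} ν ν'))
           × (∀ j → σ ∉ alph (A j) → ∀ x → x ∈ vars (A j)
                → (∀ i → σ ∈ alph (A i) → x ∉ vars (A i)) → ν' x ≡ ν x))))

  -- rules P --σ,θ--> P' of the complement B̄ (θ up to logical equivalence)
  CompRule : Subset nB → Fin L → Fml (n + n) → Subset nB → Set
  CompRule P σ θ P' =
      (∀ p' → p' ∈ P' → Σ[ r ∈ Rule T L n nB ]
          ((r ∈L Δ B) × (Rule.src r ∈ P) × (Rule.lab r ≡ σ) × (Rule.tgt r ≡ p')))
    × (∀ ν ν' → ⟦ θ ⟧ (pairV {n} ν ν') ⇔
         ( (∀ p' → p' ∈ P' → Σ[ r ∈ Rule T L n nB ]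
               ((r ∈L Δ B) × (Rule.src r ∈ P) × (Rule.lab r ≡ σ) × (Rule.tgt r ≡ p')
                 × ⟦ Rule.fml r ⟧ (pairV {n} ν ν')))
         × (∀ p' → p' ∉ P' → ∀ r → r ∈L Δ B → Rule.src r ∈ P → Rule.lab r ≡ σ
               → Rule.tgt r ≡ p' → ¬ ⟦ Rule.fml r ⟧ (pairV {n} ν ν'))))

  ProdRule : GState → Subset nB → Fin L → Fml (n + n) → GState → Subset nB → Set
  ProdRule q P σ χ q' P' =
    Σ[ φ ∈ Fml (n + n) ] Σ[ θ ∈ Fml (n + n) ]
      (ExpRule q σ φ q' × CompRule P σ θ P' × (χ ≡ _∧f_ φ θ))

  record PState : Set where
    constructor ⟨_,_,_⟩
    field
      q : GState
      P : Subset nB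
      Φ : Fml n
  open PState public

  Accepting : PState → Set
  Accepting s = (∀ i → q s i ∈ F (A i)) × (∀ p → p ∈ P s → p ∉ F B)

  IsPostFormula : Fml n → Fml (n + n) → Fml n → Set
  IsPostFormula Φ θ Ψ = ∀ ν → ⟦ Ψ ⟧ ν ⇔ (Σ[ ν' ∈ Val n ] (⟦ Φ ⟧ ν' × ⟦ θ ⟧ (pairV {n} ν' ν)))

  PostVia : PState → Fin L → Fml (n + n) → PState → Set
  PostVia s σ θ t = ProdRule (q s) (P s) σ θ (q t) (P t)
                    × IsPostFormula (Φ s) θ (Φ t) × Sat (Φ t)

  Post : PState → PState → Set
  Post s t = Σ[ σ ∈ Fin L ] Σ[ θ ∈ Fml (n + n) ] PostVia s σ θ t

  -- substates (⟨q_{i₁},…,q_{iₘ}⟩, S): the chosen indices are those with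
  -- loc i ≢ nothing, and loc i is the i-th local state.
  record Substate : Set where
    constructor sub
    field
      loc : (i : Fin N) → Maybe (Fin (nQ (A i)))
      obs : Subset nB
  open Substate public

  _⊲_ : Substate → GState × Subset nB → Set
  r ⊲ (qs , Ps) = (∀ i → (loc r i ≡ nothing) ⊎ (loc r i ≡ just (qs i)))
                × (Nonempty (obs r) → Nonempty (obs r ∩ Ps))

  SubVars : Substate → Fin n → Set
  SubVars r x = (Σ[ i ∈ Fin N ] ((Σ[ p ∈ Fin (nQ (A i)) ] (loc r i ≡ just p)) × x ∈ vars (A i)))
              ⊎ (Nonempty (obs r) × x ∈ vars B)

  record PredMap : Set where
    field
      Π    : Substate → List (Fml n)
      Π-wf : ∀ r → All (FreeIn (SubVars r)) (Π r)
  open PredMap public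

  IsSharp : PredMap → GState → Subset nB → Fml n → Fml n → Set
  IsSharp Πm qs Ps Ψ Ψ♯ = ∀ ν → ⟦ Ψ♯ ⟧ ν ⇔
    (∀ r → r ⊲ (qs , Ps) → ∀ π → π ∈L Π Πm r → _⇒_ Ψ π → ⟦ π ⟧ ν)

  PostΠVia : PredMap → PState → Fin L → Fml (n + n) → PState → Set
  PostΠVia Πm s σ θ t = ProdRule (q s) (P s) σ θ (q t) (P t)
    × (Σ[ Ψ ∈ Fml n ] (IsPostFormula (Φ s) θ Ψ × Sat Ψ × IsSharp Πm (q t) (P t) Ψ (Φ t)))

  PostΠ : PredMap → PState → PState → Set
  PostΠ Πm s t = Σ[ σ ∈ Fin L ] Σ[ θ ∈ Fml (n + n) ] PostΠVia Πm s σ θ t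

  -- a counterexample s₀,…,s_k (entries beyond k are irrelevant);
  -- σ i, θ i, Πs i are σᵢ, θᵢ, Πᵢ for i ∈ [1,k]
  record Counterexample : Set where
    field
      k      : ℕ
      s      : ℕ → PState
      σ      : ℕ → Fin L
      θ      : ℕ → Fml (n + n)
      Πs     : ℕ → PredMap
      init-q : ∀ i → q (s 0) i ≡ ι (A i)
      init-P : P (s 0) ≡ ⁅ ι B ⁆
      init-Φ : Φ (s 0) ≡ ⊤f
      steps  : ∀ i → i < k → PostΠVia (Πs (suc i)) (s i) (σ (suc i)) (θ (suc i)) (s (suc i))
      acc    : Accepting (s k)

  module _ (c : Counterexample) where
    open Counterexample c

    -- Θʲ is satisfiable (ν m is the valuation of the copy x⃗ᵐ)
    ThetaSat : ℕ → Set
    ThetaSat j = Σ[ ν ∈ (ℕ → Val n) ]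
      (⟦ Φ (s j) ⟧ (ν 0)
       × (∀ i → j < i → i ≤ k → ⟦ θ i ⟧ (pairV {n} (ν (i ∸ j ∸ 1)) (ν (i ∸ j)))))

    IsPivot : ℕ → Set
    IsPivot j = (j ≤ k) × ¬ ThetaSat j × (∀ j' → j < j' → j' ≤ k → ThetaSat j')

    Interpolant : ℕ → (ℕ → Fml n) → Set
    Interpolant j I = _⇒_ (Φ (s j)) (I 0)
      × _⇒_ (I (k ∸ j)) (⊥f)
      × (∀ i → i < k ∸ j → ∀ ν ν' → ⟦ I i ⟧ ν → ⟦ θ (j + suc i) ⟧ (pairV {n} ν ν')
           → ⟦ I (suc i) ⟧ ν')

    Compatible : ℕ → PredMap → Set
    Compatible j Πm = Σ[ I ∈ (ℕ → Fml n) ] (Interpolant j I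
      × (∀ i → i ≤ k ∸ j → Σ[ cs ∈ CNF n ] (IsCNFOf cs (I i)
          × All (λ C → Σ[ r ∈ Substate ] ((r ⊲ (q (s (i + j)) , P (s (i + j))))
                                          × (clauseF C ∈L Π Πm r))) cs)))

{-# OPTIONS --safe #-}
-- Along the abstract run every Ψ_d implies the interpolant formula I_d.  For the step, the
-- strongest postcondition of Ψ_d under θ implies I_{d+1} and hence every clause of a CNF of
-- I_{d+1}; compatibility makes each such clause a predicate of Π at the target state, so
-- Post_Π keeps it in Ψ_{d+1}.  Since Θᵏ is just Φ_k, which is satisfiable, the pivot lies
-- below k; so Ψ_{k-j} abstracts a satisfiable formula and is itself satisfiable, while
-- I_{k-j} is unsatisfiable.
module Submission where

open import Defs
open import Data.Nat using (ℕ; zero; suc; _+_; _∸_; _≤_; _<_)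
open import Data.Nat.Properties using (≤-refl; <⇒≤; <⇒≱; ≤∧≢⇒<; _≟_; m≤n+m; m+n∸n≡m; +-comm; m≤o∸n⇒m+n≤o; m<n⇒0<n∸m)
open import Data.Product using (Σ-syntax; _×_; _,_; proj₁; proj₂)
open import Data.Unit using (tt)
open import Data.Empty using (⊥-elim)
open import Data.Fin.Subset using (Subset)
open import Data.List using ([]; _∷_)
open import Data.List.Relation.Unary.All using (All; lookup)
open import Data.List.Relation.Unary.Any using (here; there)
open import Data.List.Membership.Propositional using () renaming (_∈_ to _∈L_)
open import Relation.Nullary using (¬_; yes; no)
open import Relation.Binary.PropositionalEquality using (_≡_; refl; sym; subst; subst₂)
open import Function.Bundles using (Equivalence)
open Equivalence using (to; from)

module Logic (T : Theory) where
  open FO T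

  HoareTriple : ∀ {n} → Formula n → Formula (n + n) → Formula n → Set
  HoareTriple {n} I θ I' = ∀ ν ν' → ⟦ I ⟧ ν → ⟦ θ ⟧ (pairV {n} ν ν') → ⟦ I' ⟧ ν'

  cnfF⁻ : ∀ {m} {cs : CNF m} {C} → C ∈L cs → cnfF cs ⇒ clauseF C
  cnfF⁻ {cs = _ ∷ []}     (here refl) ν h       = h
  cnfF⁻ {cs = _ ∷ _ ∷ _}  (here refl) ν (h , _) = h
  cnfF⁻ {cs = _ ∷ _ ∷ _}  (there C∈)  ν (_ , h) = cnfF⁻ C∈ ν h

  cnfF⁺ : ∀ {m} (cs : CNF m) ν → (∀ {C} → C ∈L cs → ⟦ clauseF C ⟧ ν) → ⟦ cnfF cs ⟧ ν
  cnfF⁺ []           ν h = tt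
  cnfF⁺ (_ ∷ [])     ν h = h (here refl)
  cnfF⁺ (_ ∷ _ ∷ cs) ν h = h (here refl) , cnfF⁺ (_ ∷ cs) ν (λ C∈ → h (there C∈))

  IsCNFOf⁻ : ∀ {m} {cs : CNF m} {φ C} → IsCNFOf cs φ → C ∈L cs → φ ⇒ clauseF C
  IsCNFOf⁻ cnf C∈ ν h = cnfF⁻ C∈ ν (to (cnf ν) h)

  IsCNFOf⁺ : ∀ {m} {cs : CNF m} {φ ψ} → IsCNFOf cs φ
           → (∀ {C} → C ∈L cs → ψ ⇒ clauseF C) → ψ ⇒ φ
  IsCNFOf⁺ {cs = cs} cnf h ν hψ = from (cnf ν) (cnfF⁺ cs ν (λ C∈ → h C∈ ν hψ))

module Abstraction (T : Theory) {L n : ℕ} (𝒜 : Network T L n) (Ob : Observer T L n) where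
  open FO T
  open Logic T
  open Net T 𝒜 Ob

  ClausesInΠ : PredMap → GState → Subset nB → CNF n → Set
  ClausesInΠ Πm qs Ps cs = All (λ C → Σ[ r ∈ Substate ] ((r ⊲ (qs , Ps)) × (clauseF C ∈L Π Πm r))) cs

  PostΠVia-sat : ∀ Πm s {σ θ} t → PostΠVia Πm s σ θ t → Sat (Φ t)
  PostΠVia-sat _ _ _ (_ , _ , _ , (ν , hΨ) , sharp) = ν , from (sharp ν) (λ _ _ _ _ Ψ⇒π → Ψ⇒π ν hΨ)

  PostΠVia-⇒ : ∀ Πm s {σ θ} t {cs : CNF n} I I'
             → PostΠVia Πm s σ θ t
             → Φ s ⇒ I → HoareTriple I θ I' → IsCNFOf cs I' → ClausesInΠ Πm (q t) (P t) cs
             → Φ t ⇒ I'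
  PostΠVia-⇒ _ _ t {cs} _ I' (_ , Ψpost , post , _ , sharp) Φs⇒I triple cnf inΠ =
    IsCNFOf⁺ {φ = I'} {Φ t} cnf Φt⇒clause
    where
    Ψpost⇒I' : Ψpost ⇒ I'
    Ψpost⇒I' ν h with to (post ν) h
    ... | ν' , hΨ , hθ = triple ν' ν (Φs⇒I ν' hΨ) hθ

    Φt⇒clause : ∀ {C} → C ∈L cs → Φ t ⇒ clauseF C
    Φt⇒clause C∈ ν h with lookup inΠ C∈
    ... | r , r⊲ , C∈Π =
      to (sharp ν) h r r⊲ _ C∈Π (λ ν' h' → IsCNFOf⁻ {φ = I'} cnf C∈ ν' (Ψpost⇒I' ν' h'))

  module _ (c : Counterexample) where
    open Counterexample c

    Φ-sat : ∀ m → m ≤ k → Sat (Φ (s m))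
    Φ-sat zero    _   = (λ _ → Theory.d₀ T) , subst (λ φ → ⟦ φ ⟧ (λ _ → Theory.d₀ T)) (sym init-Φ) tt
    Φ-sat (suc m) m<k = PostΠVia-sat (Πs (suc m)) (s m) (s (suc m)) (steps m m<k)

    ThetaSat-k : ThetaSat c k
    ThetaSat-k with Φ-sat k ≤-refl
    ... | ν , hΦ = (λ _ → ν) , hΦ , λ _ k<i i≤k → ⊥-elim (<⇒≱ k<i i≤k)

    IsPivot⇒< : ∀ {j} → IsPivot c j → j < k
    IsPivot⇒< {j} (j≤k , ¬Θʲ , _) with j ≟ k
    ... | yes refl = ⊥-elim (¬Θʲ ThetaSat-k)
    ... | no j≢k   = ≤∧≢⇒< j≤k j≢k

    PostΠRun : PredMap → ℕ → (ℕ → Fml n) → Set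
    PostΠRun Πm j Ψ = ∀ i → j ≤ i → i < k
      → PostΠVia Πm ⟨ q (s i) , P (s i) , Ψ (i ∸ j) ⟩ (σ (suc i)) (θ (suc i))
                    ⟨ q (s (suc i)) , P (s (suc i)) , Ψ (suc i ∸ j) ⟩

    module PostΠRunBelowInterpolant {j : ℕ} (j≤k : j ≤ k) (Πm : PredMap) (compatible : Compatible c j Πm)
                      (Ψ : ℕ → Fml n) (Ψ₀⇒Φⱼ : Ψ 0 ⇒ Φ (s j)) (run : PostΠRun Πm j Ψ) where

      I : ℕ → Fml n
      I = proj₁ compatible

      Φⱼ⇒I₀ : Φ (s j) ⇒ I 0
      Φⱼ⇒I₀ = proj₁ (proj₁ (proj₂ compatible))

      I-last⇒⊥ : I (k ∸ j) ⇒ ⊥f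
      I-last⇒⊥ = proj₁ (proj₂ (proj₁ (proj₂ compatible)))

      I-triple : ∀ d → d < k ∸ j → HoareTriple (I d) (θ (suc d + j)) (I (suc d))
      I-triple d d<k∸j = subst (λ m → HoareTriple (I d) (θ m) (I (suc d))) (+-comm j (suc d))
                               (proj₂ (proj₂ (proj₁ (proj₂ compatible))) d d<k∸j)

      I-cnf : ∀ d → d ≤ k ∸ j
            → Σ[ cs ∈ CNF n ] (IsCNFOf cs (I d) × ClausesInΠ Πm (q (s (d + j))) (P (s (d + j))) cs)
      I-cnf = proj₂ (proj₂ compatible)

      ŝ : ℕ → PState
      ŝ d = ⟨ q (s (d + j)) , P (s (d + j)) , Ψ d ⟩

      step : ∀ d → d < k ∸ j → PostΠVia Πm (ŝ d) (σ (suc d + j)) (θ (suc d + j)) (ŝ (suc d))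
      step d d<k∸j = subst₂ (λ a b → PostΠVia Πm ⟨ q (s (d + j)) , P (s (d + j)) , Ψ a ⟩ (σ (suc d + j)) (θ (suc d + j))
                                                  ⟨ q (s (suc d + j)) , P (s (suc d + j)) , Ψ b ⟩)
                            (m+n∸n≡m d j) (m+n∸n≡m (suc d) j)
                            (run (d + j) (m≤n+m j d) (m≤o∸n⇒m+n≤o (suc d) j≤k d<k∸j))

      Ψ⇒I : ∀ d → d ≤ k ∸ j → Ψ d ⇒ I d
      Ψ⇒I zero    _       ν h = Φⱼ⇒I₀ ν (Ψ₀⇒Φⱼ ν h)
      Ψ⇒I (suc d) d<k∸j with I-cnf (suc d) d<k∸j
      ... | cs , cnf , inΠ = PostΠVia-⇒ Πm (ŝ d) (ŝ (suc d)) (I d) (I (suc d)) (step d d<k∸j)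
                                        (Ψ⇒I d (<⇒≤ d<k∸j)) (I-triple d d<k∸j) cnf inΠ

      Ψ-sat : ∀ d → 0 < d → d ≤ k ∸ j → Sat (Ψ d)
      Ψ-sat (suc d) _ d<k∸j = PostΠVia-sat Πm (ŝ d) (ŝ (suc d)) (step d d<k∸j)

lemma3 : (T : Theory) {L n : ℕ} (𝒜 : Network T L n) (Ob : Observer T L n)
    → let open Net T 𝒜 Ob in
      (c : Counterexample) (j : ℕ) → IsPivot c j
    → (Πm : PredMap) → Compatible c j Πm
    → let open Counterexample c in
      ¬ (Σ[ Ψ ∈ (ℕ → Fml n) ]
          (FO._⇒_ T (Ψ 0) (Φ (s j))
           × (∀ i → j ≤ i → i < k
                → PostΠVia Πm ⟨ q (s i) , P (s i) , Ψ (i ∸ j) ⟩ (σ (suc i)) (θ (suc i))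
                              ⟨ q (s (suc i)) , P (s (suc i)) , Ψ (suc i ∸ j) ⟩)))
lemma3 T 𝒜 Ob c j pivot Πm compatible (Ψ , Ψ₀⇒Φⱼ , run) =
  let ν , hΨ = Ψ-sat (k ∸ j) (m<n⇒0<n∸m j<k) ≤-refl
  in I-last⇒⊥ ν (Ψ⇒I (k ∸ j) ≤-refl ν hΨ)
  where
  open Abstraction T 𝒜 Ob
  open Net T 𝒜 Ob using (module Counterexample)
  open Counterexample c using (k)

  j<k : j < k
  j<k = IsPivot⇒< c pivot

  open PostΠRunBelowInterpolant c (<⇒≤ j<k) Πm compatible Ψ Ψ₀⇒Φⱼ run
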